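{- Let $\eta\in\{0,1\}$ and $\alpha\in\{ -1,1\}$. Let $\overrightarrow{G}$ be a digraph without loops or multiple arcs, with vertex set $\{v_1,\dots,v_n\}$ and $m$ arcs. Define $g(\overrightarrow{G};x)=d_2\bigl(xI_n-\eta D(\overrightarrow{G})-\alpha A(\overrightarrow{G})\bigr)$. Then $$(m-n)\,g(\overrightarrow{G};x)+x\,g'(\overrightarrow{G};x)=\sum_{\overrightarrow{e}\in E(\overrightarrow{G})}g(\overrightarrow{G}-\overrightarrow{e};x),$$ where $g'$ is the derivative with respect to $x$ and $\overrightarrow{G}-\overrightarrow{e}$ is the digraph on the same vertex set with the arc $\overrightarrow{e}$ deleted (and $g(\overrightarrow{G}-\overrightarrow{e};x)$ is computed with the in-degree matrix and adjacency matrix of $\overrightarrow{G}-\overrightarrow{e}$).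
   Context: For a digraph $\overrightarrow{K}$ on vertices $v_1,\dots,v_k$, $A(\overrightarrow{K})=(a_{ij})$ is its adjacency matrix with $a_{ij}=1$ if $(v_i,v_j)$ is an arc and $0$ otherwise, and $D(\overrightarrow{K})=\mathrm{diag}(d^-(v_1),\dots,d^-(v_k))$ is the diagonal matrix of in-degrees. For a $k\times k$ matrix $X=(x_{st})$, the second immanant is $d_2(X)=\sum_{\sigma\in S_k}\chi_2(\sigma)\prod_s x_{s\sigma(s)}$ with $\chi_2$ the irreducible character of $S_k$ for the partition $(2,1^{k-2})$; equivalently $d_2(X)=\sum_{i=1}^k x_{ii}\det(X(i))-\det(X)$, where $X(i)$ is $X$ with row and column $i$ deleted. -}

module Defs where

open import Data.Nat as ℕ using (ℕ; zero; suc)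
open import Data.Integer as ℤ using (ℤ; +_; -_; _+_; _-_; _*_; -1ℤ)
open import Data.Fin using (Fin; zero; suc; toℕ; punchIn; _≟_)
open import Data.Bool using (Bool; true; false; if_then_else_; _∧_; not)
open import Relation.Nullary.Decidable using (⌊_⌋)
open import Relation.Binary.PropositionalEquality using (_≡_)

ΣF : {A : Set} → (A → A → A) → A → (n : ℕ) → (Fin n → A) → A
ΣF _⊕_ e zero    f = e
ΣF _⊕_ e (suc n) f = f zero ⊕ ΣF _⊕_ e n (λ i → f (suc i))

Σℕ : (n : ℕ) → (Fin n → ℕ) → ℕ
Σℕ = ΣF ℕ._+_ 0

Σℤ : (n : ℕ) → (Fin n → ℤ) → ℤ
Σℤ = ΣF _+_ (+ 0)

-- Polynomials in x over ℤ, represented by their coefficient sequence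
-- (p k = coefficient of x^k).  Equality is coefficientwise.

Poly : Set
Poly = ℕ → ℤ

_≈P_ : Poly → Poly → Set
p ≈P q = (k : ℕ) → p k ≡ q k

infix 4 _≈P_

constP : ℤ → Poly
constP c zero    = c
constP c (suc k) = + 0

0P 1P : Poly
0P = constP (+ 0)
1P = constP (+ 1)

xP : Poly
xP zero          = + 0
xP (suc zero)    = + 1
xP (suc (suc k)) = + 0

_+P_ : Poly → Poly → Poly
(p +P q) k = p k + q k

-P_ : Poly → Poly
(-P p) k = - p k

_-P_ : Poly → Poly → Poly
p -P q = p +P (-P q)

_*P_ : Poly → Poly → Poly
(p *P q) k = Σℤ (suc k) (λ i → p (toℕ i) * q (k ℕ.∸ toℕ i))

infixl 6 _+P_ _-P_
infixl 7 _*P_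

derivP : Poly → Poly
derivP p k = + (suc k) * p (suc k)

ΣP : (n : ℕ) → (Fin n → Poly) → Poly
ΣP = ΣF _+P_ 0P

Matrix : ℕ → Set
Matrix n = Fin n → Fin n → Poly

minor : {n : ℕ} → Fin (suc n) → Fin (suc n) → Matrix (suc n) → Matrix n
minor i j M a b = M (punchIn i a) (punchIn j b)

signP : ℕ → Poly
signP zero    = 1P
signP (suc k) = -P signP k

det : {n : ℕ} → Matrix n → Poly
det {zero}  M = 1P
det {suc n} M = ΣP (suc n) (λ j → signP (toℕ j) *P M zero j *P det (minor zero j M))

d₂ : {n : ℕ} → Matrix n → Poly
d₂ {zero}  M = -P det M
d₂ {suc n} M = ΣP (suc n) (λ i → M i i *P det (minor i i M)) -P det M

-- Digraphs on vertex set Fin n without loops or multiple arcs: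
-- adj u v = true iff (u , v) is an arc.

Adj : ℕ → Set
Adj n = Fin n → Fin n → Bool

Loopless : {n : ℕ} → Adj n → Set
Loopless {n} a = (i : Fin n) → a i i ≡ false

b2ℕ : Bool → ℕ
b2ℕ true  = 1
b2ℕ false = 0

b2ℤ : Bool → ℤ
b2ℤ true  = + 1
b2ℤ false = + 0

arcCount : {n : ℕ} → Adj n → ℕ
arcCount {n} a = Σℕ n (λ u → Σℕ n (λ v → b2ℕ (a u v)))

indeg : {n : ℕ} → Adj n → Fin n → ℕ
indeg {n} a v = Σℕ n (λ u → b2ℕ (a u v))

deleteArc : {n : ℕ} → Adj n → Fin n → Fin n → Adj n
deleteArc a i j u v = a u v ∧ not (⌊ u ≟ i ⌋ ∧ ⌊ v ≟ j ⌋)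

charMatrix : {n : ℕ} → ℤ → ℤ → Adj n → Matrix n
charMatrix η α a i j =
  (if ⌊ i ≟ j ⌋ then xP -P constP (η * + indeg a j) else 0P)
  -P constP (α * b2ℤ (a i j))

g : {n : ℕ} → ℤ → ℤ → Adj n → Poly
g η α a = d₂ (charMatrix η α a)

module Submission where

open import Defs
open import Data.Nat using (ℕ)
open import Data.Integer using (ℤ; +_; -_; _-_)
open import Data.Fin using (Fin)
open import Data.Bool using (if_then_else_)
open import Data.Sum using (_⊎_)
open import Relation.Binary.PropositionalEquality using (_≡_)

open import Algebra.Bundles using (Monoid; CommutativeMonoid; AbelianGroup)
import Algebra.Construct.Pointwise as Pointwise
import Algebra.Properties.CommutativeMonoid.Sum as CommutativeMonoidSum
open import Data.Bool using (true; false; _∧_; not)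
open import Data.Bool.Properties using (∧-identityʳ; ∧-zeroʳ)
open import Data.Fin using (zero; suc; toℕ; punchIn; punchOut; _≟_)
open import Data.Fin.Properties
  using (toℕ≤pred[n]; punchIn-injective; punchInᵢ≢i; punchIn-punchOut)
open import Data.Integer using (_+_; _*_)
import Data.Integer.Properties as ℤ
open import Algebra.Properties.Group (AbelianGroup.group ℤ.+-0-abelianGroup)
  using (identityʳ-unique)
open import Data.Integer.Tactic.RingSolver using (solve-∀)
open import Data.Nat as ℕ using (zero; suc; _∸_)
open import Data.Nat.Properties using (m+[n∸m]≡n)
open import Data.Product using (_×_; _,_; proj₁; proj₂)
open import Data.Vec.Functional using (foldr; removeAt)
open import Function using (_∘_)
open import Level using (0ℓ)
open import Relation.Binary.PropositionalEquality
  using (refl; cong; cong₂; subst; _≢_; module ≡-Reasoning)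
import Relation.Binary.PropositionalEquality as ≡
import Relation.Binary.Reasoning.Setoid as SetoidReasoning
open import Relation.Nullary using (yes; no)
open import Relation.Nullary.Decidable using (⌊_⌋)
open import Relation.Nullary.Negation using (contradiction)

-- Write M = xI − ηD − αA and θ = x d/dx (euler below), so that x g′ = θ g.
-- The immanant d₂ is additive in each column and θ acts on it by the Leibniz
-- rule, so θ d₂(M) = Σ_j d₂(X_j), where X_j is M with column j replaced by θ
-- of it, namely x e_j.  Column j of M is x e_j minus the sum over the arcs
-- (u, j) of w_uj = η e_j + α e_u, and deleting the arc (i, j) adds w_ij back
-- to that column.  With M_uj the matrix M with column j replaced by w_uj,
-- additivity in column j gives
--   d₂(X_j) = d₂(M) + Σ_{(u,j) arc} d₂(M_uj),   g(G − (i,j)) = d₂(M) + d₂(M_ij),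
-- so θ g = n g + S and Σ_e g(G − e) = m g + S with S = Σ_{(i,j) arc} d₂(M_ij).

ΣF≡foldr : {A : Set} (_⊕_ : A → A → A) (e : A) (n : ℕ) (f : Fin n → A) →
           ΣF _⊕_ e n f ≡ foldr _⊕_ e f
ΣF≡foldr _⊕_ e zero    f = refl
ΣF≡foldr _⊕_ e (suc n) f = cong (f zero ⊕_) (ΣF≡foldr _⊕_ e n (f ∘ suc))

module _ (N : Monoid 0ℓ 0ℓ) where
  open Monoid N

  ΣF-homo : {A : Set} (_⊕_ : A → A → A) (e : A) (φ : A → Carrier) →
            φ e ≈ ε → (∀ x y → φ (x ⊕ y) ≈ φ x ∙ φ y) →
            ∀ n (f : Fin n → A) → φ (ΣF _⊕_ e n f) ≈ ΣF _∙_ ε n (φ ∘ f)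
  ΣF-homo _⊕_ e φ φ-ε φ-∙ zero    f = φ-ε
  ΣF-homo _⊕_ e φ φ-ε φ-∙ (suc n) f =
    trans (φ-∙ _ _) (∙-congˡ (ΣF-homo _⊕_ e φ φ-ε φ-∙ n (f ∘ suc)))

module ΣF-Properties (M : CommutativeMonoid 0ℓ 0ℓ) where
  open CommutativeMonoid M
  open CommutativeMonoidSum M
  open SetoidReasoning setoid

  private
    Σ : (n : ℕ) → (Fin n → Carrier) → Carrier
    Σ = ΣF _∙_ ε

    Σ≈sum : ∀ n f → Σ n f ≈ sum f
    Σ≈sum n f = reflexive (ΣF≡foldr _∙_ ε n f)

  Σ-cong : ∀ n {f g : Fin n → Carrier} → (∀ i → f i ≈ g i) → Σ n f ≈ Σ n g
  Σ-cong n {f} {g} f≈g = begin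
    Σ n f  ≈⟨ Σ≈sum n f ⟩
    sum f  ≈⟨ sum-cong-≋ {x = f} {y = g} f≈g ⟩
    sum g  ≈⟨ Σ≈sum n g ⟨
    Σ n g  ∎

  Σ-zero : ∀ n → Σ n (λ _ → ε) ≈ ε
  Σ-zero n = trans (Σ≈sum n (λ _ → ε)) (sum-replicate-zero n)

  Σ-distrib : ∀ n (f g : Fin n → Carrier) → Σ n (λ i → f i ∙ g i) ≈ Σ n f ∙ Σ n g
  Σ-distrib n f g = begin
    Σ n (λ i → f i ∙ g i)  ≈⟨ Σ≈sum n _ ⟩
    sum (λ i → f i ∙ g i)  ≈⟨ ∑-distrib-+ f g ⟩
    sum f ∙ sum g          ≈⟨ ∙-cong (Σ≈sum n f) (Σ≈sum n g) ⟨
    Σ n f ∙ Σ n g          ∎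

  Σ-comm : ∀ m n (f : Fin m → Fin n → Carrier) →
           Σ m (λ i → Σ n (f i)) ≈ Σ n (λ j → Σ m (λ i → f i j))
  Σ-comm m n f = begin
    Σ m (λ i → Σ n (f i))          ≈⟨ Σ-cong m (λ i → Σ≈sum n (f i)) ⟩
    Σ m (λ i → sum (f i))          ≈⟨ Σ≈sum m _ ⟩
    sum (λ i → sum (f i))          ≈⟨ ∑-comm f ⟩
    sum (λ j → sum (λ i → f i j))  ≈⟨ Σ≈sum n _ ⟨
    Σ n (λ j → sum (λ i → f i j))  ≈⟨ Σ-cong n (λ j → Σ≈sum m (λ i → f i j)) ⟨
    Σ n (λ j → Σ m (λ i → f i j))  ∎

  Σ-remove : ∀ n (f : Fin (suc n) → Carrier) i → Σ (suc n) f ≈ f i ∙ Σ n (removeAt f i)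
  Σ-remove n f i = begin
    Σ (suc n) f               ≈⟨ Σ≈sum (suc n) f ⟩
    sum f                     ≈⟨ sum-remove f ⟩
    f i ∙ sum (removeAt f i)  ≈⟨ ∙-congˡ (Σ≈sum n (removeAt f i)) ⟨
    f i ∙ Σ n (removeAt f i)  ∎

open ΣF-Properties ℤ.+-0-commutativeMonoid
  using () renaming (Σ-cong to Σℤ-cong; Σ-zero to Σℤ-zero; Σ-distrib to Σℤ-distrib;
                     Σ-remove to Σℤ-remove)

*-distribˡ-Σℤ : ∀ n c (f : Fin n → ℤ) → c * Σℤ n f ≡ Σℤ n (λ i → c * f i)
*-distribˡ-Σℤ n c = ΣF-homo ℤ.+-0-monoid _+_ (+ 0) (c *_) (ℤ.*-zeroʳ c) (ℤ.*-distribˡ-+ c) n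

*-distribʳ-Σℤ : ∀ n c (f : Fin n → ℤ) → Σℤ n f * c ≡ Σℤ n (λ i → f i * c)
*-distribʳ-Σℤ n c =
  ΣF-homo ℤ.+-0-monoid _+_ (+ 0) (_* c) (ℤ.*-zeroˡ c) (λ x y → ℤ.*-distribʳ-+ c x y) n

+-Σℕ : ∀ n (f : Fin n → ℕ) → + Σℕ n f ≡ Σℤ n (λ i → + f i)
+-Σℕ = ΣF-homo ℤ.+-0-monoid ℕ._+_ 0 +_ refl ℤ.pos-+

0P-coeff : ∀ k → 0P k ≡ + 0
0P-coeff zero    = refl
0P-coeff (suc k) = refl

+P-commutativeMonoid : CommutativeMonoid 0ℓ 0ℓ
+P-commutativeMonoid = record
  { Carrier             = Poly
  ; _≈_                 = _≈P_
  ; _∙_                 = _+P_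
  ; ε                   = 0P
  ; isCommutativeMonoid = record
    { isMonoid = record
      { isSemigroup = Pointwise.isSemigroup ℕ ℤ.+-isSemigroup
      ; identity    = (λ p k → ≡.trans (cong (_+ p k) (0P-coeff k)) (ℤ.+-identityˡ (p k)))
                    , (λ p k → ≡.trans (cong (_+_ (p k)) (0P-coeff k)) (ℤ.+-identityʳ (p k)))
      }
    ; comm     = λ p q k → ℤ.+-comm (p k) (q k)
    }
  }

open CommutativeMonoid +P-commutativeMonoid
  using () renaming (monoid to +P-monoid; setoid to ≈P-setoid; sym to ≈P-sym; trans to ≈P-trans;
                     reflexive to ≡⇒≈P; ∙-cong to +P-cong; identityˡ to +P-identityˡ;
                     identityʳ to +P-identityʳ)
module ≈P-Reasoning = SetoidReasoning ≈P-setoid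

open ΣF-Properties +P-commutativeMonoid
  using () renaming (Σ-cong to ΣP-cong; Σ-distrib to ΣP-distrib; Σ-comm to ΣP-comm;
                     Σ-remove to ΣP-remove)

+P-congˡ : ∀ p {q q′} → q ≈P q′ → p +P q ≈P p +P q′
+P-congˡ p = +P-cong {x = p} {y = p} (λ _ → refl)

+P-congʳ : ∀ q {p p′} → p ≈P p′ → p +P q ≈P p′ +P q
+P-congʳ q p≈p′ = +P-cong {u = q} {v = q} p≈p′ (λ _ → refl)

neg-distrib-ΣP : ∀ n (f : Fin n → Poly) → -P ΣP n f ≈P ΣP n (λ i → -P f i)
neg-distrib-ΣP = ΣF-homo +P-monoid _+P_ 0P -P_
  (λ k → ≡.trans (cong -_ (0P-coeff k)) (≡.sym (0P-coeff k)))
  (λ p q k → ℤ.neg-distrib-+ (p k) (q k))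

constP-Σℤ : ∀ n (f : Fin n → ℤ) → constP (Σℤ n f) ≈P ΣP n (λ i → constP (f i))
constP-Σℤ = ΣF-homo +P-monoid _+_ (+ 0) constP (λ _ → refl) constP-+
  where
  constP-+ : ∀ x y → constP (x + y) ≈P constP x +P constP y
  constP-+ x y zero    = refl
  constP-+ x y (suc k) = refl

_·P_ : ℤ → Poly → Poly
(c ·P p) k = c * p k

infixl 7 _·P_

·P-distribʳ-Σℤ : ∀ n (f : Fin n → ℤ) p → Σℤ n f ·P p ≈P ΣP n (λ i → f i ·P p)
·P-distribʳ-Σℤ n f p = ΣF-homo +P-monoid _+_ (+ 0) (_·P p) (λ k → ≡.sym (0P-coeff k))
  (λ x y k → ℤ.*-distribʳ-+ (p k) x y) n f

ΣP-const : ∀ n p → ΣP n (λ _ → p) ≈P + n ·P p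
ΣP-const zero    p k = 0P-coeff k
ΣP-const (suc n) p k = begin
  p k + ΣP n (λ _ → p) k  ≡⟨ cong (_+_ (p k)) (ΣP-const n p k) ⟩
  p k + + n * p k         ≡⟨ cong (_+ + n * p k) (ℤ.*-identityˡ (p k)) ⟨
  + 1 * p k + + n * p k   ≡⟨ ℤ.*-distribʳ-+ (p k) (+ 1) (+ n) ⟨
  + suc n * p k           ∎
  where open ≡-Reasoning

cauchyTerm : Poly → Poly → (k : ℕ) → Fin (suc k) → ℤ
cauchyTerm p q k i = p (toℕ i) * q (k ∸ toℕ i)

*P-cong : ∀ {p p′ q q′} → p ≈P p′ → q ≈P q′ → p *P q ≈P p′ *P q′
*P-cong {p} {p′} {q} {q′} p≈p′ q≈q′ k =
  Σℤ-cong (suc k) {cauchyTerm p q k} {cauchyTerm p′ q′ k}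
    (λ i → cong₂ _*_ (p≈p′ (toℕ i)) (q≈q′ (k ∸ toℕ i)))

*P-congˡ : ∀ p {q q′} → q ≈P q′ → p *P q ≈P p *P q′
*P-congˡ p = *P-cong {p} {p} (λ _ → refl)

*P-congʳ : ∀ q {p p′} → p ≈P p′ → p *P q ≈P p′ *P q
*P-congʳ q p≈p′ = *P-cong {q = q} {q′ = q} p≈p′ (λ _ → refl)

*P-distribˡ : ∀ p q r → p *P (q +P r) ≈P p *P q +P p *P r
*P-distribˡ p q r k = ≡.trans
  (Σℤ-cong (suc k) {cauchyTerm p (q +P r) k}
    (λ i → ℤ.*-distribˡ-+ (p (toℕ i)) (q (k ∸ toℕ i)) (r (k ∸ toℕ i))))
  (Σℤ-distrib (suc k) (cauchyTerm p q k) (cauchyTerm p r k))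

*P-distribʳ : ∀ p q r → (p +P q) *P r ≈P p *P r +P q *P r
*P-distribʳ p q r k = ≡.trans
  (Σℤ-cong (suc k) {cauchyTerm (p +P q) r k}
    (λ i → ℤ.*-distribʳ-+ (r (k ∸ toℕ i)) (p (toℕ i)) (q (toℕ i))))
  (Σℤ-distrib (suc k) (cauchyTerm p r k) (cauchyTerm q r k))

*P-zeroˡ : ∀ p → 0P *P p ≈P 0P
*P-zeroˡ p k = ≡.trans
  (Σℤ-cong (suc k) {cauchyTerm 0P p k} (λ i →
    ≡.trans (cong (_* p (k ∸ toℕ i)) (0P-coeff (toℕ i))) (ℤ.*-zeroˡ (p (k ∸ toℕ i)))))
  (≡.trans (Σℤ-zero (suc k)) (≡.sym (0P-coeff k)))

*P-zeroʳ : ∀ p → p *P 0P ≈P 0P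
*P-zeroʳ p k = ≡.trans
  (Σℤ-cong (suc k) {cauchyTerm p 0P k} (λ i →
    ≡.trans (cong (p (toℕ i) *_) (0P-coeff (k ∸ toℕ i))) (ℤ.*-zeroʳ (p (toℕ i)))))
  (≡.trans (Σℤ-zero (suc k)) (≡.sym (0P-coeff k)))

*P-distribˡ-ΣP : ∀ n p (f : Fin n → Poly) → p *P ΣP n f ≈P ΣP n (λ i → p *P f i)
*P-distribˡ-ΣP n p = ΣF-homo +P-monoid _+P_ 0P (p *P_) (*P-zeroʳ p) (*P-distribˡ p) n

constP-*P : ∀ c p → constP c *P p ≈P c ·P p
constP-*P c p k = ≡.trans (cong (_+_ (c * p k)) (Σℤ-zero k)) (ℤ.+-identityʳ (c * p k))

*P-identityˡ : ∀ p → 1P *P p ≈P p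
*P-identityˡ p k = ≡.trans (constP-*P (+ 1) p k) (ℤ.*-identityˡ (p k))

-- The Euler operator x d/dx

euler : Poly → Poly
euler p k = + k * p k

x*P-derivP : ∀ p → xP *P derivP p ≈P euler p
x*P-derivP p zero    = refl
x*P-derivP p (suc k) = begin
  + 0 + (+ 1 * derivP p k + Σℤ k (λ _ → + 0))
    ≡⟨ ℤ.+-identityˡ _ ⟩
  + 1 * derivP p k + Σℤ k (λ _ → + 0)
    ≡⟨ cong₂ _+_ (ℤ.*-identityˡ (derivP p k)) (Σℤ-zero k) ⟩
  derivP p k + + 0
    ≡⟨ ℤ.+-identityʳ (derivP p k) ⟩
  derivP p k
    ∎
  where open ≡-Reasoning

IsConstant : Poly → Set
IsConstant p = ∀ k → p (suc k) ≡ + 0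

signP-constant : ∀ t → IsConstant (signP t)
signP-constant zero    k = refl
signP-constant (suc t) k = cong -_ (signP-constant t k)

euler-constant : ∀ p → IsConstant p → euler p ≈P 0P
euler-constant p p-const zero    = refl
euler-constant p p-const (suc k) = ≡.trans (cong (+ suc k *_) (p-const k)) (ℤ.*-zeroʳ (+ suc k))

euler-xP : euler xP ≈P xP
euler-xP zero          = refl
euler-xP (suc zero)    = refl
euler-xP (suc (suc k)) = ℤ.*-zeroʳ (+ suc (suc k))

euler-cong : ∀ {p q} → p ≈P q → euler p ≈P euler q
euler-cong p≈q k = cong (+ k *_) (p≈q k)

euler-+P : ∀ p q → euler (p +P q) ≈P euler p +P euler q
euler-+P p q k = ℤ.*-distribˡ-+ (+ k) (p k) (q k)

euler-neg : ∀ p → euler (-P p) ≈P -P euler p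
euler-neg p k = ≡.sym (ℤ.neg-distribʳ-* (+ k) (p k))

euler-ΣP : ∀ n (f : Fin n → Poly) → euler (ΣP n f) ≈P ΣP n (λ i → euler (f i))
euler-ΣP = ΣF-homo +P-monoid _+P_ 0P euler (euler-constant 0P (λ _ → refl)) euler-+P

euler-*P : ∀ p q → euler (p *P q) ≈P euler p *P q +P p *P euler q
euler-*P p q k = begin
  + k * Σℤ (suc k) (cauchyTerm p q k)
    ≡⟨ *-distribˡ-Σℤ (suc k) (+ k) (cauchyTerm p q k) ⟩
  Σℤ (suc k) (λ i → + k * cauchyTerm p q k i)
    ≡⟨ Σℤ-cong (suc k) (λ i → split (toℕ≤pred[n] i) (p (toℕ i)) (q (k ∸ toℕ i))) ⟩
  Σℤ (suc k) (λ i → cauchyTerm (euler p) q k i + cauchyTerm p (euler q) k i)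
    ≡⟨ Σℤ-distrib (suc k) (cauchyTerm (euler p) q k) (cauchyTerm p (euler q) k) ⟩
  (euler p *P q +P p *P euler q) k
    ∎
  where
  open ≡-Reasoning
  split : ∀ {t} → t ℕ.≤ k → ∀ x y → + k * (x * y) ≡ (+ t * x) * y + x * (+ (k ∸ t) * y)
  split {t} t≤k x y = begin
    + k * (x * y)                        ≡⟨ cong (λ m → + m * (x * y)) (m+[n∸m]≡n t≤k) ⟨
    + (t ℕ.+ (k ∸ t)) * (x * y)          ≡⟨ cong (_* (x * y)) (ℤ.pos-+ t (k ∸ t)) ⟩
    (+ t + + (k ∸ t)) * (x * y)          ≡⟨ distrib (+ t) (+ (k ∸ t)) x y ⟩
    (+ t * x) * y + x * (+ (k ∸ t) * y)  ∎
    where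
    distrib : ∀ a b x y → (a + b) * (x * y) ≡ (a * x) * y + x * (b * y)
    distrib = solve-∀

euler-*P-constant : ∀ s → IsConstant s → ∀ p → euler (s *P p) ≈P s *P euler p
euler-*P-constant s s-const p = begin
  euler (s *P p)                ≈⟨ euler-*P s p ⟩
  euler s *P p +P s *P euler p  ≈⟨ +P-congʳ (s *P euler p) (*P-congʳ p (euler-constant s s-const)) ⟩
  0P *P p +P s *P euler p       ≈⟨ +P-congʳ (s *P euler p) (*P-zeroˡ p) ⟩
  0P +P s *P euler p            ≈⟨ +P-identityˡ (s *P euler p) ⟩
  s *P euler p                  ∎
  where open ≈P-Reasoning

-- Column additivity and the Leibniz rule for det and d₂

AgreeOffColumn : ∀ {n} → Fin n → Matrix n → Matrix n → Set
AgreeOffColumn {n} j M N = ∀ r c → c ≢ j → M r c ≈P N r c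

ColumnAdditive : ∀ {n} → (Matrix n → Poly) → Set
ColumnAdditive {n} F =
  ∀ j (M N P : Matrix n) → AgreeOffColumn j M N → AgreeOffColumn j M P →
  (∀ r → M r j ≈P N r j +P P r j) → F M ≈P F N +P F P

EulerColumns : ∀ {n} → Matrix n → (Fin n → Matrix n) → Set
EulerColumns {n} M N = ∀ j → AgreeOffColumn j (N j) M × (∀ r → N j r j ≈P euler (M r j))

ColumnLeibniz : ∀ {n} → (Matrix n → Poly) → Set
ColumnLeibniz {n} F = ∀ M N → EulerColumns M N → euler (F M) ≈P ΣP n (λ j → F (N j))

module _ {n : ℕ} where
  open ≈P-Reasoning

  columnAdditive-resp : {F G : Matrix n → Poly} → (∀ M → F M ≈P G M) →
                        ColumnAdditive G → ColumnAdditive F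
  columnAdditive-resp {F} {G} F≈G G-add j M N P hN hP hj = begin
    F M         ≈⟨ F≈G M ⟩
    G M         ≈⟨ G-add j M N P hN hP hj ⟩
    G N +P G P  ≈⟨ +P-cong (F≈G N) (F≈G P) ⟨
    F N +P F P  ∎

  columnAdditive-ΣP : ∀ m (F : Fin m → Matrix n → Poly) → (∀ i → ColumnAdditive (F i)) →
                      ColumnAdditive (λ M → ΣP m (λ i → F i M))
  columnAdditive-ΣP m F F-add j M N P hN hP hj = begin
    ΣP m (λ i → F i M)                        ≈⟨ ΣP-cong m (λ i → F-add i j M N P hN hP hj) ⟩
    ΣP m (λ i → F i N +P F i P)               ≈⟨ ΣP-distrib m (λ i → F i N) (λ i → F i P) ⟩
    ΣP m (λ i → F i N) +P ΣP m (λ i → F i P)  ∎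

  columnAdditive-sub : {F G : Matrix n → Poly} → ColumnAdditive F → ColumnAdditive G →
                      ColumnAdditive (λ M → F M -P G M)
  columnAdditive-sub {F} {G} F-add G-add j M N P hN hP hj = begin
    F M -P G M
      ≈⟨ +P-cong (F-add j M N P hN hP hj) (λ k → cong -_ (G-add j M N P hN hP hj k)) ⟩
    (F N +P F P) -P (G N +P G P)
      ≈⟨ (λ k → interchange (F N k) (F P k) (G N k) (G P k)) ⟩
    (F N -P G N) +P (F P -P G P)
      ∎
    where
    interchange : ∀ a b c d → (a + b) + - (c + d) ≡ (a + - c) + (b + - d)
    interchange = solve-∀

  columnLeibniz-resp : {F G : Matrix n → Poly} → (∀ M → F M ≈P G M) →
                       ColumnLeibniz G → ColumnLeibniz F
  columnLeibniz-resp {F} {G} F≈G G-leib M N eN = begin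
    euler (F M)           ≈⟨ euler-cong (F≈G M) ⟩
    euler (G M)           ≈⟨ G-leib M N eN ⟩
    ΣP n (λ j → G (N j))  ≈⟨ ΣP-cong n (λ j → F≈G (N j)) ⟨
    ΣP n (λ j → F (N j))  ∎

  columnLeibniz-ΣP : ∀ m (F : Fin m → Matrix n → Poly) → (∀ i → ColumnLeibniz (F i)) →
                     ColumnLeibniz (λ M → ΣP m (λ i → F i M))
  columnLeibniz-ΣP m F F-leib M N eN = begin
    euler (ΣP m (λ i → F i M))           ≈⟨ euler-ΣP m (λ i → F i M) ⟩
    ΣP m (λ i → euler (F i M))           ≈⟨ ΣP-cong m (λ i → F-leib i M N eN) ⟩
    ΣP m (λ i → ΣP n (λ j → F i (N j)))  ≈⟨ ΣP-comm m n (λ i j → F i (N j)) ⟩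
    ΣP n (λ j → ΣP m (λ i → F i (N j)))  ∎

  columnLeibniz-sub : {F G : Matrix n → Poly} → ColumnLeibniz F → ColumnLeibniz G →
                     ColumnLeibniz (λ M → F M -P G M)
  columnLeibniz-sub {F} {G} F-leib G-leib M N eN = begin
    euler (F M -P G M)
      ≈⟨ euler-+P (F M) (-P G M) ⟩
    euler (F M) +P euler (-P G M)
      ≈⟨ +P-congˡ (euler (F M)) (euler-neg (G M)) ⟩
    euler (F M) -P euler (G M)
      ≈⟨ +P-cong (F-leib M N eN) (λ k → cong -_ (G-leib M N eN k)) ⟩
    ΣP n (λ j → F (N j)) -P ΣP n (λ j → G (N j))
      ≈⟨ +P-congˡ (ΣP n (λ j → F (N j))) (neg-distrib-ΣP n (λ j → G (N j))) ⟩
    ΣP n (λ j → F (N j)) +P ΣP n (λ j → -P G (N j))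
      ≈⟨ ΣP-distrib n (λ j → F (N j)) (λ j → -P G (N j)) ⟨
    ΣP n (λ j → F (N j) -P G (N j))
      ∎

data PunchInView {n} (c : Fin (suc n)) : Fin (suc n) → Set where
  at      : PunchInView c c
  punched : ∀ j → PunchInView c (punchIn c j)

punchInView : ∀ {n} (c j : Fin (suc n)) → PunchInView c j
punchInView c j with c ≟ j
... | yes refl = at
... | no c≢j   = subst (PunchInView c) (punchIn-punchOut c≢j) (punched (punchOut c≢j))

det-cong : ∀ {n} (M N : Matrix n) → (∀ r c → M r c ≈P N r c) → det M ≈P det N
det-cong {zero}  M N M≈N = λ _ → refl
det-cong {suc n} M N M≈N = ΣP-cong (suc n) λ c →
  *P-cong (*P-congˡ (signP (toℕ c)) (M≈N zero c))
          (det-cong (minor zero c M) (minor zero c N) (λ r c′ → M≈N (suc r) (punchIn c c′)))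

det-minor-cong : ∀ {n} {c} {M N : Matrix (suc n)} r → AgreeOffColumn c M N →
                 det (minor r c M) ≈P det (minor r c N)
det-minor-cong {c = c} {M} {N} r agree = det-cong (minor r c M) (minor r c N)
  (λ a b → agree (punchIn r a) (punchIn c b) (punchInᵢ≢i c b))

AgreeOffColumn-minor : ∀ {n} {M N : Matrix (suc n)} r c j → AgreeOffColumn (punchIn c j) M N →
                       AgreeOffColumn j (minor r c M) (minor r c N)
AgreeOffColumn-minor r c j agree a b b≢j =
  agree (punchIn r a) (punchIn c b) (b≢j ∘ punchIn-injective c b j)

EulerColumns-minor : ∀ {n} {M : Matrix (suc n)} {N} r c → EulerColumns M N →
                     EulerColumns (minor r c M) (λ j → minor r c (N (punchIn c j)))
EulerColumns-minor r c eN j =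
    AgreeOffColumn-minor r c j (proj₁ (eN (punchIn c j)))
  , λ a → proj₂ (eN (punchIn c j)) (punchIn r a)

-- det M = Σ_c laplaceTerm (±1) 0 c M and d₂ M + det M = Σ_i laplaceTerm 1 i i M.
laplaceTerm : ∀ {n} → Poly → Fin (suc n) → Fin (suc n) → Matrix (suc n) → Poly
laplaceTerm s r c M = s *P M r c *P det (minor r c M)

laplaceTerm-additive : ∀ {n} → ColumnAdditive (det {n}) → ∀ s r c →
                       ColumnAdditive (laplaceTerm {n} s r c)
laplaceTerm-additive det-add s r c j M N P hN hP hj with punchInView c j
... | at = begin
  s *P M r c *P D
    ≈⟨ *P-congʳ D (*P-congˡ s (hj r)) ⟩
  s *P (N r c +P P r c) *P D
    ≈⟨ *P-congʳ D (*P-distribˡ s (N r c) (P r c)) ⟩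
  (s *P N r c +P s *P P r c) *P D
    ≈⟨ *P-distribʳ (s *P N r c) (s *P P r c) D ⟩
  s *P N r c *P D +P s *P P r c *P D
    ≈⟨ +P-cong (*P-congˡ (s *P N r c) (det-minor-cong r hN))
               (*P-congˡ (s *P P r c) (det-minor-cong r hP)) ⟩
  laplaceTerm s r c N +P laplaceTerm s r c P
    ∎
  where
  open ≈P-Reasoning
  D = det (minor r c M)
... | punched j′ = begin
  s *P M r c *P det (minor r c M)
    ≈⟨ *P-congˡ (s *P M r c) (det-add j′ (minor r c M) (minor r c N) (minor r c P)
         (AgreeOffColumn-minor r c j′ hN) (AgreeOffColumn-minor r c j′ hP) (λ a → hj (punchIn r a))) ⟩
  s *P M r c *P (det (minor r c N) +P det (minor r c P))
    ≈⟨ *P-distribˡ (s *P M r c) (det (minor r c N)) (det (minor r c P)) ⟩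
  s *P M r c *P det (minor r c N) +P s *P M r c *P det (minor r c P)
    ≈⟨ +P-cong (*P-congʳ (det (minor r c N)) (*P-congˡ s (hN r c c≢j)))
               (*P-congʳ (det (minor r c P)) (*P-congˡ s (hP r c c≢j))) ⟩
  laplaceTerm s r c N +P laplaceTerm s r c P
    ∎
  where
  open ≈P-Reasoning
  c≢j : c ≢ punchIn c j′
  c≢j = punchInᵢ≢i c j′ ∘ ≡.sym

laplaceTerm-leibniz : ∀ {n} → ColumnLeibniz (det {n}) → ∀ s → IsConstant s → ∀ r c →
                      ColumnLeibniz (laplaceTerm {n} s r c)
laplaceTerm-leibniz {n} det-leib s s-const r c M N eN = begin
  euler (s *P M r c *P D)
    ≈⟨ euler-*P (s *P M r c) D ⟩
  euler (s *P M r c) *P D +P s *P M r c *P euler D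
    ≈⟨ +P-cong (*P-congʳ D (euler-*P-constant s s-const (M r c)))
               (*P-congˡ (s *P M r c) (det-leib (minor r c M) N′ (EulerColumns-minor r c eN))) ⟩
  s *P euler (M r c) *P D +P s *P M r c *P ΣP n (λ j → det (N′ j))
    ≈⟨ +P-cong differentiated undifferentiated ⟩
  laplaceTerm s r c (N c) +P ΣP n (λ j → laplaceTerm s r c (N (punchIn c j)))
    ≈⟨ ΣP-remove n (λ j → laplaceTerm s r c (N j)) c ⟨
  ΣP (suc n) (λ j → laplaceTerm s r c (N j))
    ∎
  where
  open ≈P-Reasoning
  D  = det (minor r c M)
  N′ = λ j → minor r c (N (punchIn c j))

  differentiated : s *P euler (M r c) *P D ≈P laplaceTerm s r c (N c)
  differentiated =
    ≈P-sym (*P-cong (*P-congˡ s (proj₂ (eN c) r)) (det-minor-cong r (proj₁ (eN c))))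

  undifferentiated : s *P M r c *P ΣP n (λ j → det (N′ j)) ≈P
                     ΣP n (λ j → laplaceTerm s r c (N (punchIn c j)))
  undifferentiated = ≈P-trans (*P-distribˡ-ΣP n (s *P M r c) (λ j → det (N′ j)))
    (ΣP-cong n λ j → *P-congʳ (det (N′ j)) (*P-congˡ s
      (≈P-sym (proj₁ (eN (punchIn c j)) r c (punchInᵢ≢i c j ∘ ≡.sym)))))

det-additive : ∀ n → ColumnAdditive (det {n})
det-additive zero    ()
det-additive (suc n) = columnAdditive-ΣP (suc n) (λ c → laplaceTerm (signP (toℕ c)) zero c)
  (λ c → laplaceTerm-additive (det-additive n) (signP (toℕ c)) zero c)

det-leibniz : ∀ n → ColumnLeibniz (det {n})
det-leibniz zero    M N eN = euler-constant 1P (λ _ → refl)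
det-leibniz (suc n) = columnLeibniz-ΣP (suc n) (λ c → laplaceTerm (signP (toℕ c)) zero c)
  (λ c → laplaceTerm-leibniz (det-leibniz n) (signP (toℕ c)) (signP-constant (toℕ c)) zero c)

d₂-laplace : ∀ {n} (M : Matrix (suc n)) →
             d₂ M ≈P ΣP (suc n) (λ i → laplaceTerm 1P i i M) -P det M
d₂-laplace {n} M = +P-congʳ (-P det M) (ΣP-cong (suc n) λ i →
  *P-congʳ (det (minor i i M)) (≈P-sym (*P-identityˡ (M i i))))

d₂-additive : ∀ n → ColumnAdditive (d₂ {n})
d₂-additive zero    ()
d₂-additive (suc n) = columnAdditive-resp d₂-laplace (columnAdditive-sub
  (columnAdditive-ΣP (suc n) (λ i → laplaceTerm 1P i i)
    (λ i → laplaceTerm-additive (det-additive n) 1P i i))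
  (det-additive (suc n)))

d₂-leibniz : ∀ n → ColumnLeibniz (d₂ {n})
d₂-leibniz zero    M N eN = euler-constant (-P 1P) (λ _ → refl)
d₂-leibniz (suc n) = columnLeibniz-resp d₂-laplace (columnLeibniz-sub
  (columnLeibniz-ΣP (suc n) (λ i → laplaceTerm 1P i i)
    (λ i → laplaceTerm-leibniz (det-leibniz n) 1P (λ _ → refl) i i))
  (det-leibniz (suc n)))

replaceColumn : ∀ {n} → Matrix n → Fin n → (Fin n → Poly) → Matrix n
replaceColumn M j v r c = if ⌊ c ≟ j ⌋ then v r else M r c

replaceColumn-at : ∀ {n} (M : Matrix n) j v r → replaceColumn M j v r j ≡ v r
replaceColumn-at M j v r with j ≟ j
... | yes _   = refl
... | no j≢j = contradiction refl j≢j

replaceColumn-agree : ∀ {n} (M : Matrix n) j v → AgreeOffColumn j (replaceColumn M j v) M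
replaceColumn-agree M j v r c c≢j with c ≟ j
... | yes c≡j = contradiction c≡j c≢j
... | no _    = λ _ → refl

agree-replaceColumn : ∀ {n} {N M : Matrix n} {j} v → AgreeOffColumn j N M →
                      AgreeOffColumn j N (replaceColumn M j v)
agree-replaceColumn {M = M} {j} v agree r c c≢j k =
  ≡.trans (agree r c c≢j k) (≡.sym (replaceColumn-agree M j v r c c≢j k))

module _ {n} {F : Matrix n → Poly} (F-add : ColumnAdditive F) (M : Matrix n) (j : Fin n) where

  replaceColumn-zero : F (replaceColumn M j (λ _ → 0P)) ≈P 0P
  replaceColumn-zero k =
    ≡.trans (identityʳ-unique (F Z k) (F Z k) (≡.sym (doubled k))) (≡.sym (0P-coeff k))
    where
    Z = replaceColumn M j (λ _ → 0P)
    doubled : F Z ≈P F Z +P F Z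
    doubled = F-add j Z Z Z (λ _ _ _ _ → refl) (λ _ _ _ _ → refl) λ r →
      subst (λ p → p ≈P p +P p) (≡.sym (replaceColumn-at M j (λ _ → 0P) r))
            (≈P-sym (+P-identityˡ 0P))

  replaceColumn-+P : ∀ u v → F (replaceColumn M j (λ r → u r +P v r)) ≈P
                             F (replaceColumn M j u) +P F (replaceColumn M j v)
  replaceColumn-+P u v = F-add j (replaceColumn M j w) (replaceColumn M j u) (replaceColumn M j v)
    (agree-replaceColumn u (replaceColumn-agree M j w))
    (agree-replaceColumn v (replaceColumn-agree M j w))
    (λ r → ≡⇒≈P (≡.trans (replaceColumn-at M j w r)
                   (≡.sym (cong₂ _+P_ (replaceColumn-at M j u r) (replaceColumn-at M j v r)))))
    where
    w = λ r → u r +P v r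

  replaceColumn-ΣP : ∀ m (v : Fin m → Fin n → Poly) →
                     F (replaceColumn M j (λ r → ΣP m (λ i → v i r))) ≈P
                     ΣP m (λ i → F (replaceColumn M j (v i)))
  replaceColumn-ΣP zero    v = replaceColumn-zero
  replaceColumn-ΣP (suc m) v = ≈P-trans
    (replaceColumn-+P (v zero) (λ r → ΣP m (λ i → v (suc i) r)))
    (+P-congˡ (F (replaceColumn M j (v zero))) (replaceColumn-ΣP m (v ∘ suc)))

  replaceColumn-if : ∀ t v → F (replaceColumn M j (λ r → if t then v r else 0P)) ≈P
                             (if t then F (replaceColumn M j v) else 0P)
  replaceColumn-if true  v = λ _ → refl
  replaceColumn-if false v = replaceColumn-zero

δ : ∀ {n} → Fin n → Fin n → ℤ
δ r c = b2ℤ ⌊ r ≟ c ⌋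

δ-diag : ∀ {n} (r : Fin n) → δ r r ≡ + 1
δ-diag r with r ≟ r
... | yes _   = refl
... | no r≢r = contradiction refl r≢r

Σℤ-δ : ∀ n (f : Fin n → ℤ) r → Σℤ n (λ u → f u * δ r u) ≡ f r
Σℤ-δ (suc n) f r = begin
  Σℤ (suc n) (λ u → f u * δ r u)
    ≡⟨ Σℤ-remove n (λ u → f u * δ r u) r ⟩
  f r * δ r r + Σℤ n (λ u → f (punchIn r u) * δ r (punchIn r u))
    ≡⟨ cong₂ _+_ (cong (f r *_) (δ-diag r)) (Σℤ-cong n off-diagonal) ⟩
  f r * + 1 + Σℤ n (λ _ → + 0)
    ≡⟨ cong₂ _+_ (ℤ.*-identityʳ (f r)) (Σℤ-zero n) ⟩
  f r + + 0
    ≡⟨ ℤ.+-identityʳ (f r) ⟩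
  f r
    ∎
  where
  open ≡-Reasoning
  off-diagonal : ∀ u → f (punchIn r u) * δ r (punchIn r u) ≡ + 0
  off-diagonal u with r ≟ punchIn r u
  ... | yes r≡r′ = contradiction (≡.sym r≡r′) (punchInᵢ≢i r u)
  ... | no _     = ℤ.*-zeroʳ (f (punchIn r u))

+b2ℕ : ∀ t → + b2ℕ t ≡ b2ℤ t
+b2ℕ true  = refl
+b2ℕ false = refl

indeg-Σℤ : ∀ {n} (a : Adj n) c → + indeg a c ≡ Σℤ n (λ u → b2ℤ (a u c))
indeg-Σℤ {n} a c = ≡.trans (+-Σℕ n (λ u → b2ℕ (a u c))) (Σℤ-cong n (λ u → +b2ℕ (a u c)))

arcCount-Σℤ : ∀ {n} (a : Adj n) → + arcCount a ≡ Σℤ n (λ u → Σℤ n (λ v → b2ℤ (a u v)))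
arcCount-Σℤ {n} a = ≡.trans (+-Σℕ n (λ u → Σℕ n (λ v → b2ℕ (a u v))))
  (Σℤ-cong n (λ u → ≡.trans (+-Σℕ n (λ v → b2ℕ (a u v))) (Σℤ-cong n (λ v → +b2ℕ (a u v)))))

deleteArc-at : ∀ {n} (a : Adj n) i j → deleteArc a i j i j ≡ false
deleteArc-at a i j with i ≟ i | j ≟ j
... | yes _   | yes _   = ∧-zeroʳ (a i j)
... | no i≢i | _       = contradiction refl i≢i
... | _       | no j≢j = contradiction refl j≢j

deleteArc-≢ˡ : ∀ {n} (a : Adj n) i j u v → u ≢ i → deleteArc a i j u v ≡ a u v
deleteArc-≢ˡ a i j u v u≢i with u ≟ i
... | yes u≡i = contradiction u≡i u≢i
... | no _    = ∧-identityʳ (a u v)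

deleteArc-≢ʳ : ∀ {n} (a : Adj n) i j u v → v ≢ j → deleteArc a i j u v ≡ a u v
deleteArc-≢ʳ a i j u v v≢j with v ≟ j
... | yes v≡j = contradiction v≡j v≢j
... | no _    = ≡.trans (cong (λ t → a u v ∧ not t) (∧-zeroʳ ⌊ u ≟ i ⌋)) (∧-identityʳ (a u v))

arcSum : ∀ {n} → Adj n → (Fin n → Fin n → Poly) → Poly
arcSum {n} a F = ΣP n (λ i → ΣP n (λ j → if a i j then F i j else 0P))

arcSum-cong : ∀ {n} (a : Adj n) {F G} → (∀ i j → a i j ≡ true → F i j ≈P G i j) →
              arcSum a F ≈P arcSum a G
arcSum-cong {n} a {F} {G} F≈G = ΣP-cong n λ i → ΣP-cong n λ j → on-arc i j
  where
  on-arc : ∀ i j → (if a i j then F i j else 0P) ≈P (if a i j then G i j else 0P)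
  on-arc i j with a i j in aij
  ... | true  = F≈G i j aij
  ... | false = λ _ → refl

arcSum-+P : ∀ {n} (a : Adj n) F G →
            arcSum a (λ i j → F i j +P G i j) ≈P arcSum a F +P arcSum a G
arcSum-+P {n} a F G = begin
  ΣP n (λ i → ΣP n (λ j → if a i j then F i j +P G i j else 0P))
    ≈⟨ ΣP-cong n (λ i → ΣP-cong n (λ j → if-+P (a i j) (F i j) (G i j))) ⟩
  ΣP n (λ i → ΣP n (λ j → F′ i j +P G′ i j))
    ≈⟨ ΣP-cong n (λ i → ΣP-distrib n (F′ i) (G′ i)) ⟩
  ΣP n (λ i → ΣP n (F′ i) +P ΣP n (G′ i))
    ≈⟨ ΣP-distrib n (λ i → ΣP n (F′ i)) (λ i → ΣP n (G′ i)) ⟩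
  arcSum a F +P arcSum a G
    ∎
  where
  open ≈P-Reasoning
  F′ G′ : Fin n → Fin n → Poly
  F′ i j = if a i j then F i j else 0P
  G′ i j = if a i j then G i j else 0P
  if-+P : ∀ t p q → (if t then p +P q else 0P) ≈P (if t then p else 0P) +P (if t then q else 0P)
  if-+P true  p q = λ _ → refl
  if-+P false p q = ≈P-sym (+P-identityˡ 0P)

arcSum-const : ∀ {n} (a : Adj n) p → arcSum a (λ _ _ → p) ≈P + arcCount a ·P p
arcSum-const {n} a p = begin
  ΣP n (λ i → ΣP n (λ j → if a i j then p else 0P))
    ≈⟨ ΣP-cong n (λ i → ΣP-cong n (λ j → if-·P (a i j))) ⟩
  ΣP n (λ i → ΣP n (λ j → b2ℤ (a i j) ·P p))
    ≈⟨ ΣP-cong n (λ i → ·P-distribʳ-Σℤ n (λ j → b2ℤ (a i j)) p) ⟨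
  ΣP n (λ i → Σℤ n (λ j → b2ℤ (a i j)) ·P p)
    ≈⟨ ·P-distribʳ-Σℤ n (λ i → Σℤ n (λ j → b2ℤ (a i j))) p ⟨
  Σℤ n (λ i → Σℤ n (λ j → b2ℤ (a i j))) ·P p
    ≈⟨ (λ k → cong (_* p k) (arcCount-Σℤ a)) ⟨
  + arcCount a ·P p
    ∎
  where
  open ≈P-Reasoning
  if-·P : ∀ t → (if t then p else 0P) ≈P b2ℤ t ·P p
  if-·P true  k = ≡.sym (ℤ.*-identityˡ (p k))
  if-·P false k = 0P-coeff k

xI : ∀ {n} → Matrix n
xI r c = if ⌊ r ≟ c ⌋ then xP else 0P

euler-xI : ∀ {n} (r c : Fin n) → euler (xI r c) ≈P xI r c
euler-xI r c with ⌊ r ≟ c ⌋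
... | true  = euler-xP
... | false = euler-constant 0P (λ _ → refl)

module _ (η α : ℤ) where

  -- The arc (u , c) contributes η e_c + α e_u to column c of η D + α A.
  arcColumn : ∀ {n} → Fin n → Fin n → Fin n → ℤ
  arcColumn u c r = δ r c * η + δ r u * α

  columnLoad : ∀ {n} → Adj n → Fin n → Fin n → ℤ
  columnLoad {n} a c r = Σℤ n (λ u → b2ℤ (a u c) * arcColumn u c r)

  columnLoad-degrees : ∀ {n} (a : Adj n) c r →
                       columnLoad a c r ≡ + indeg a c * (δ r c * η) + b2ℤ (a r c) * α
  columnLoad-degrees {n} a c r = begin
    Σℤ n (λ u → b u * arcColumn u c r)
      ≡⟨ Σℤ-cong n (λ u → split (b u) (δ r c * η) (δ r u) α) ⟩
    Σℤ n (λ u → b u * (δ r c * η) + (b u * α) * δ r u)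
      ≡⟨ Σℤ-distrib n (λ u → b u * (δ r c * η)) (λ u → (b u * α) * δ r u) ⟩
    Σℤ n (λ u → b u * (δ r c * η)) + Σℤ n (λ u → (b u * α) * δ r u)
      ≡⟨ cong₂ _+_ (≡.sym (*-distribʳ-Σℤ n (δ r c * η) b)) (Σℤ-δ n (λ u → b u * α) r) ⟩
    Σℤ n b * (δ r c * η) + b r * α
      ≡⟨ cong (λ d → d * (δ r c * η) + b r * α) (indeg-Σℤ a c) ⟨
    + indeg a c * (δ r c * η) + b r * α
      ∎
    where
    open ≡-Reasoning
    b = λ u → b2ℤ (a u c)
    split : ∀ x y z w → x * (y + z * w) ≡ x * y + (x * w) * z
    split = solve-∀

  charMatrix-entry : ∀ {n} (a : Adj n) r c →
                     charMatrix η α a r c ≈P xI r c -P constP (columnLoad a c r)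
  charMatrix-entry a r c k = ≡.trans (diagonal ⌊ r ≟ c ⌋ (+ indeg a c) (b2ℤ (a r c)) k)
    (cong (λ z → xI r c k + - constP z k) (≡.sym (columnLoad-degrees a c r)))
    where
    diagonal : ∀ t d β → (if t then xP -P constP (η * d) else 0P) -P constP (α * β) ≈P
                         (if t then xP else 0P) -P constP (d * (b2ℤ t * η) + β * α)
    diagonal true  d β zero    = on-diagonal η α d β
      where
      on-diagonal : ∀ η α d β → (+ 0 + - (η * d)) + - (α * β) ≡ + 0 + - (d * (+ 1 * η) + β * α)
      on-diagonal = solve-∀
    diagonal true  d β (suc k) = cong (λ z → z + + 0) (ℤ.+-identityʳ (xP (suc k)))
    diagonal false d β zero    = off-diagonal η α d β
      where
      off-diagonal : ∀ η α d β → + 0 + - (α * β) ≡ + 0 + - (d * (+ 0 * η) + β * α)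
      off-diagonal = solve-∀
    diagonal false d β (suc k) = refl

  euler-charMatrix : ∀ {n} (a : Adj n) r c → euler (charMatrix η α a r c) ≈P xI r c
  euler-charMatrix a r c = begin
    euler (charMatrix η α a r c)
      ≈⟨ euler-cong (charMatrix-entry a r c) ⟩
    euler (xI r c -P constP (columnLoad a c r))
      ≈⟨ euler-+P (xI r c) (-P constP (columnLoad a c r)) ⟩
    euler (xI r c) +P euler (-P constP (columnLoad a c r))
      ≈⟨ +P-cong (euler-xI r c) (euler-constant (-P constP (columnLoad a c r)) (λ _ → refl)) ⟩
    xI r c +P 0P
      ≈⟨ +P-identityʳ (xI r c) ⟩
    xI r c
      ∎
    where open ≈P-Reasoning

  charMatrix-cong : ∀ {n} (a b : Adj n) c → (∀ u → a u c ≡ b u c) → ∀ r →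
                    charMatrix η α a r c ≈P charMatrix η α b r c
  charMatrix-cong {n} a b c a≡b r = begin
    charMatrix η α a r c
      ≈⟨ charMatrix-entry a r c ⟩
    xI r c -P constP (columnLoad a c r)
      ≈⟨ +P-congˡ (xI r c) (λ k → cong (λ z → - constP z k) same-load) ⟩
    xI r c -P constP (columnLoad b c r)
      ≈⟨ charMatrix-entry b r c ⟨
    charMatrix η α b r c
      ∎
    where
    open ≈P-Reasoning
    same-load : columnLoad a c r ≡ columnLoad b c r
    same-load = Σℤ-cong n (λ u → cong (λ t → b2ℤ t * arcColumn u c r) (a≡b u))

  columnLoad-deleteArc : ∀ {n} (a : Adj n) i j r → a i j ≡ true →
                         columnLoad a j r ≡ arcColumn i j r + columnLoad (deleteArc a i j) j r
  columnLoad-deleteArc {suc n} a i j r aij = begin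
    columnLoad a j r
      ≡⟨ Σℤ-remove n (load a) i ⟩
    b2ℤ (a i j) * w i + Σℤ n (removeAt (load a) i)
      ≡⟨ cong₂ _+_ (cong (λ t → b2ℤ t * w i) aij) (Σℤ-cong n kept) ⟩
    + 1 * w i + Σℤ n (removeAt (load a′) i)
      ≡⟨ cong (_+ Σℤ n (removeAt (load a′) i)) (ℤ.*-identityˡ (w i)) ⟩
    w i + Σℤ n (removeAt (load a′) i)
      ≡⟨ cong (_+_ (w i)) (ℤ.+-identityˡ (Σℤ n (removeAt (load a′) i))) ⟨
    w i + (+ 0 + Σℤ n (removeAt (load a′) i))
      ≡⟨ cong (λ t → w i + (b2ℤ t * w i + Σℤ n (removeAt (load a′) i))) (deleteArc-at a i j) ⟨
    w i + (b2ℤ (a′ i j) * w i + Σℤ n (removeAt (load a′) i))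
      ≡⟨ cong (_+_ (w i)) (Σℤ-remove n (load a′) i) ⟨
    w i + columnLoad a′ j r
      ∎
    where
    open ≡-Reasoning
    a′ = deleteArc a i j
    w : Fin (suc n) → ℤ
    w u = arcColumn u j r
    load : Adj (suc n) → Fin (suc n) → ℤ
    load b u = b2ℤ (b u j) * w u
    kept : ∀ u → load a (punchIn i u) ≡ load a′ (punchIn i u)
    kept u = cong (λ t → b2ℤ t * w (punchIn i u))
      (≡.sym (deleteArc-≢ˡ a i j (punchIn i u) j (punchInᵢ≢i i u)))

  charMatrix-deleteArc : ∀ {n} (a : Adj n) i j r → a i j ≡ true →
    charMatrix η α (deleteArc a i j) r j ≈P charMatrix η α a r j +P constP (arcColumn i j r)
  charMatrix-deleteArc a i j r aij = begin
    charMatrix η α (deleteArc a i j) r j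
      ≈⟨ charMatrix-entry (deleteArc a i j) r j ⟩
    xI r j -P constP L′
      ≈⟨ shift (xI r j) (arcColumn i j r) L′ ⟩
    (xI r j -P constP (arcColumn i j r + L′)) +P constP (arcColumn i j r)
      ≈⟨ +P-congʳ (constP (arcColumn i j r)) (+P-congˡ (xI r j)
           (λ k → cong (λ z → - constP z k) (columnLoad-deleteArc a i j r aij))) ⟨
    (xI r j -P constP (columnLoad a j r)) +P constP (arcColumn i j r)
      ≈⟨ +P-congʳ (constP (arcColumn i j r)) (charMatrix-entry a r j) ⟨
    charMatrix η α a r j +P constP (arcColumn i j r)
      ∎
    where
    open ≈P-Reasoning
    L′ = columnLoad (deleteArc a i j) j r
    shift : ∀ p w l → p -P constP l ≈P (p -P constP (w + l)) +P constP w
    shift p w l zero    = shift₀ (p 0) w l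
      where
      shift₀ : ∀ x w l → x + - l ≡ (x + - (w + l)) + w
      shift₀ = solve-∀
    shift p w l (suc k) = ≡.sym (ℤ.+-identityʳ (p (suc k) + + 0))

  arcMatrix : ∀ {n} → Adj n → Fin n → Fin n → Matrix n
  arcMatrix a i j = replaceColumn (charMatrix η α a) j (λ r → constP (arcColumn i j r))

  g-deleteArc : ∀ {n} (a : Adj n) i j → a i j ≡ true →
                g η α (deleteArc a i j) ≈P g η α a +P d₂ (arcMatrix a i j)
  g-deleteArc {n} a i j aij =
    d₂-additive n j M′ M (arcMatrix a i j) M′≈M (agree-replaceColumn _ M′≈M) column
    where
    M  = charMatrix η α a
    M′ = charMatrix η α (deleteArc a i j)
    M′≈M : AgreeOffColumn j M′ M
    M′≈M r c c≢j = charMatrix-cong (deleteArc a i j) a c (λ u → deleteArc-≢ʳ a i j u c c≢j) r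
    column : ∀ r → M′ r j ≈P M r j +P arcMatrix a i j r j
    column r = ≈P-trans (charMatrix-deleteArc a i j r aij)
      (+P-congˡ (M r j) (≡⇒≈P (≡.sym (replaceColumn-at M j (λ r → constP (arcColumn i j r)) r))))

  d₂-xColumn : ∀ {n} (a : Adj n) j →
               d₂ (replaceColumn (charMatrix η α a) j (λ r → xI r j)) ≈P
               g η α a +P ΣP n (λ u → if a u j then d₂ (arcMatrix a u j) else 0P)
  d₂-xColumn {n} a j = begin
    d₂ X
      ≈⟨ d₂-additive n j X M (replaceColumn M j L) (replaceColumn-agree M j (λ r → xI r j))
           (agree-replaceColumn L (replaceColumn-agree M j (λ r → xI r j))) column ⟩
    d₂ M +P d₂ (replaceColumn M j L)
      ≈⟨ +P-congˡ (d₂ M) (replaceColumn-ΣP (d₂-additive n) M j n arcEntry) ⟩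
    d₂ M +P ΣP n (λ u → d₂ (replaceColumn M j (arcEntry u)))
      ≈⟨ +P-congˡ (d₂ M) (ΣP-cong n (λ u →
           replaceColumn-if (d₂-additive n) M j (a u j) (λ r → constP (arcColumn u j r)))) ⟩
    d₂ M +P ΣP n (λ u → if a u j then d₂ (arcMatrix a u j) else 0P)
      ∎
    where
    open ≈P-Reasoning
    M = charMatrix η α a
    X = replaceColumn M j (λ r → xI r j)
    arcEntry : Fin n → Fin n → Poly
    arcEntry u r = if a u j then constP (arcColumn u j r) else 0P
    L : Fin n → Poly
    L r = ΣP n (λ u → arcEntry u r)

    constP-if : ∀ t z → constP (b2ℤ t * z) ≈P (if t then constP z else 0P)
    constP-if true  z k = cong (λ y → constP y k) (ℤ.*-identityˡ z)
    constP-if false z k = refl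

    column : ∀ r → X r j ≈P M r j +P replaceColumn M j L r j
    column r = begin
      X r j
        ≡⟨ replaceColumn-at M j (λ r → xI r j) r ⟩
      xI r j
        ≈⟨ (λ k → unshift (xI r j k) (constP (columnLoad a j r) k)) ⟨
      (xI r j -P constP (columnLoad a j r)) +P constP (columnLoad a j r)
        ≈⟨ +P-cong (≈P-sym (charMatrix-entry a r j))
                   (constP-Σℤ n (λ u → b2ℤ (a u j) * arcColumn u j r)) ⟩
      M r j +P ΣP n (λ u → constP (b2ℤ (a u j) * arcColumn u j r))
        ≈⟨ +P-congˡ (M r j) (ΣP-cong n (λ u → constP-if (a u j) (arcColumn u j r))) ⟩
      M r j +P L r
        ≡⟨ cong (M r j +P_) (replaceColumn-at M j L r) ⟨
      M r j +P replaceColumn M j L r j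
        ∎
      where
      unshift : ∀ x y → (x + - y) + y ≡ x
      unshift = solve-∀

  euler-g : ∀ {n} (a : Adj n) →
            euler (g η α a) ≈P + n ·P g η α a +P arcSum a (λ i j → d₂ (arcMatrix a i j))
  euler-g {n} a = begin
    euler (d₂ M)
      ≈⟨ d₂-leibniz n M X (λ j → replaceColumn-agree M j (λ r → xI r j) , euler-column j) ⟩
    ΣP n (λ j → d₂ (X j))
      ≈⟨ ΣP-cong n (d₂-xColumn a) ⟩
    ΣP n (λ j → d₂ M +P Y j)
      ≈⟨ ΣP-distrib n (λ _ → d₂ M) Y ⟩
    ΣP n (λ _ → d₂ M) +P ΣP n Y
      ≈⟨ +P-cong (ΣP-const n (d₂ M))
                 (ΣP-comm n n (λ j i → if a i j then d₂ (arcMatrix a i j) else 0P)) ⟩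
    + n ·P d₂ M +P arcSum a (λ i j → d₂ (arcMatrix a i j))
      ∎
    where
    open ≈P-Reasoning
    M = charMatrix η α a
    X : Fin n → Matrix n
    X j = replaceColumn M j (λ r → xI r j)
    Y : Fin n → Poly
    Y j = ΣP n (λ i → if a i j then d₂ (arcMatrix a i j) else 0P)
    euler-column : ∀ j r → X j r j ≈P euler (M r j)
    euler-column j r = ≈P-trans (≡⇒≈P (replaceColumn-at M j (λ r → xI r j) r))
                                (≈P-sym (euler-charMatrix a r j))

  arcSum-g-deleteArc : ∀ {n} (a : Adj n) →
    arcSum a (λ i j → g η α (deleteArc a i j)) ≈P
    + arcCount a ·P g η α a +P arcSum a (λ i j → d₂ (arcMatrix a i j))
  arcSum-g-deleteArc a = begin
    arcSum a (λ i j → g η α (deleteArc a i j))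
      ≈⟨ arcSum-cong a (g-deleteArc a) ⟩
    arcSum a (λ i j → g η α a +P d₂ (arcMatrix a i j))
      ≈⟨ arcSum-+P a (λ _ _ → g η α a) (λ i j → d₂ (arcMatrix a i j)) ⟩
    arcSum a (λ _ _ → g η α a) +P arcSum a (λ i j → d₂ (arcMatrix a i j))
      ≈⟨ +P-congʳ (arcSum a (λ i j → d₂ (arcMatrix a i j))) (arcSum-const a (g η α a)) ⟩
    + arcCount a ·P g η α a +P arcSum a (λ i j → d₂ (arcMatrix a i j))
      ∎
    where open ≈P-Reasoning

lemma3p5 : (η α : ℤ) → (η ≡ + 0 ⊎ η ≡ + 1) → (α ≡ - (+ 1) ⊎ α ≡ + 1)
    → (n : ℕ) → (a : Adj n) → Loopless a
    → constP (+ arcCount a - + n) *P g η α a +P xP *P derivP (g η α a)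
      ≈P ΣP n (λ i → ΣP n (λ j → if a i j then g η α (deleteArc a i j) else 0P))
lemma3p5 η α _ _ n a _ = begin
  constP (+ m - + n) *P G +P xP *P derivP G   ≈⟨ +P-cong (constP-*P (+ m - + n) G) (x*P-derivP G) ⟩
  (+ m - + n) ·P G +P euler G                 ≈⟨ +P-congˡ ((+ m - + n) ·P G) (euler-g η α a) ⟩
  (+ m - + n) ·P G +P (+ n ·P G +P S)         ≈⟨ (λ k → regroup (+ m) (+ n) (G k) (S k)) ⟩
  + m ·P G +P S                               ≈⟨ arcSum-g-deleteArc η α a ⟨
  arcSum a (λ i j → g η α (deleteArc a i j))  ∎
  where
  open ≈P-Reasoning
  m = arcCount a
  G = g η α a
  S = arcSum a (λ i j → d₂ (arcMatrix η α a i j))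
  regroup : ∀ m n x s → (m - n) * x + (n * x + s) ≡ m * x + s
  regroup = solve-∀
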